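{- If $T$ is a $\beta(1,0)$-tree with $h(T)=T$, then $T$ has one of the following structures: (F0) $T$ is the one-node tree. (F1) There is a $\beta(1,0)$-tree $A$ such that $T$ is obtained as follows: take $h(A)$, change the label of its root to $1$ (unless it is $1$ already), and attach the root of the result by a new edge as a new rightmost child of the root of $A$; finally set the root label equal to the sum of the labels of its children. (F2) There are a $\beta(1,0)$-tree $A_1$, an integer $b>1$, and a $\beta(1,0)$-tree $A_2$ with at least two nodes, $h(A_2)=A_2$ and $\mathrm{root}(A_2)\ge b-1$, such that $T$ is obtained as follows: attach (the root of) $h(A_1)$ by a new edge as a new rightmost child of the $(b-1)$-th node on the rightmost path of $A_2$ (nodes on this path counted from the root, the root being the first); in the rightmost path of the resulting tree, add $1$ to the label of every non-root node from the $(b-1)$-th node upwards (if any), and set the label of the $b$-th node (the root of the attached copy of $h(A_1)$) to $1$; change the root label to $b$, and call the result $A_2'$. Then attach the root of $A_2'$ by a new edge as a new rightmost child of the root of $A_1$, and set the root label equal to the sum of the labels of its children.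
   Context: A $\beta(1,0)$-tree is a rooted plane tree (the children of each node are linearly ordered from left to right) whose nodes are labeled with positive integers such that: leaves have label $1$; the root has label equal to the sum of its children's labels; every other node has label between $1$ and the sum of its children's labels. (The one-node tree consists of a single node with label $1$.) For a $\beta(1,0)$-tree $T$, $\mathrm{root}(T)$ is the label of the root, the rightmost path is the path from the root obtained by repeatedly passing to the rightmost child until reaching a leaf, and $\mathrm{rpath}(T)$ is its number of edges. The depth of a node is its distance from the root. The map $h$ on $\beta(1,0)$-trees is defined recursively (it is a well-defined map with $\mathrm{rpath}(h(A))=\mathrm{root}(A)$ for every $A$ with at least two nodes): (i) $h$ maps the one-node tree and the one-edge tree to themselves. (ii) If the root of $T$ has exactly one child $v$, $v$ has label $c$, and $v$ is not a leaf: let $A$ be the subtree rooted at $v$, with the label of $v$ replaced by the sum of the labels of its children. Then $h(T)$ is obtained from $h(A)$ by attaching a new leaf (label $1$) as the new rightmost child of the node at depth $c-1$ on the rightmost path of $h(A)$, and increasing by $1$ the labels of all nodes on the rightmost path above the new leaf (i.e. at depths $0,1,\dots,c-1$). (iii) If the root of $T$ has at least two children: let $A$ be the tree formed by the root and all its subtrees except the rightmost one, with root label equal to the sum of the labels of those children, and let $B$ be the tree formed by the root and its rightmost subtree, with root label equal to the label of the rightmost child. Then $h(T)$ is obtained by identifying the rightmost leaf of $h(B)$ with the root of $h(A)$, the identified node keeping label $1$. -}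

module Defs where

open import Data.Nat using (ℕ; zero; suc; _+_; _∸_; _≤_)
open import Data.Product using (_×_)
open import Data.Unit using (⊤)
open import Relation.Binary.PropositionalEquality using (_≡_)

-- Rooted plane trees with ℕ labels.
-- The children of a node form a *snoc* forest: the rightmost child is
-- the last one added, i.e.  node l (fs ▸ t)  has rightmost child t.

data Tree : Set
data Forest : Set

data Tree where
  node : ℕ → Forest → Tree

infixl 5 _▸_
data Forest where
  []  : Forest
  _▸_ : Forest → Tree → Forest

label : Tree → ℕ
label (node l _) = l

root : Tree → ℕ
root = label

sumF : Forest → ℕ
sumF []       = 0
sumF (fs ▸ t) = sumF fs + label t

size  : Tree → ℕ
sizeF : Forest → ℕ
size (node _ fs) = suc (sizeF fs)
sizeF []       = 0
sizeF (fs ▸ t) = sizeF fs + size t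

NonRootOK : Tree → Set
ForestOK  : Forest → Set
NonRootOK (node l [])       = l ≡ 1
NonRootOK (node l (fs ▸ t)) = 1 ≤ l × l ≤ sumF (fs ▸ t) × ForestOK (fs ▸ t)
ForestOK []       = ⊤
ForestOK (fs ▸ t) = ForestOK fs × NonRootOK t

IsBeta : Tree → Set
IsBeta (node l [])       = l ≡ 1
IsBeta (node l (fs ▸ t)) = l ≡ sumF (fs ▸ t) × ForestOK (fs ▸ t)

leaf : Tree
leaf = node 1 []

oneEdge : Tree
oneEdge = node 1 ([] ▸ leaf)

setRoot : ℕ → Tree → Tree
setRoot b (node _ fs) = node b fs

fixRoot : Tree → Tree
fixRoot (node _ fs) = node (sumF fs) fs

addChild : Tree → Tree → Tree
addChild (node l fs) x = node l (fs ▸ x)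

-- graft d x T : attach x as a new rightmost child of the node at depth d
-- on the rightmost path of T, and add 1 to the labels of the rightmost-path
-- nodes at depths 0,1,…,d.  (If the rightmost path is shorter than d,
-- which never happens in the uses below, the tree is returned unchanged
-- below the end of the path.)
graft : ℕ → Tree → Tree → Tree
graft zero    x (node l fs)       = node (suc l) (fs ▸ x)
graft (suc d) x (node l [])       = node l []
graft (suc d) x (node l (fs ▸ t)) = node (suc l) (fs ▸ graft d x t)

-- glue y x : identify the rightmost leaf of y with the root of x,
-- the identified node having label 1.
glue : Tree → Tree → Tree
glue (node l [])       x = setRoot 1 x
glue (node l (fs ▸ t)) x = node l (fs ▸ glue t x)

-- The map h.  h(T) depends only on the children of the root of T.
--   hC fs : h of a tree whose root has children fs
--   hT t  : h of a tree whose root has the single child t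
-- Clauses: (i)  hC [] = one-node tree,  hT leaf-child = one-edge tree;
--          (ii) hT (node c gs) with gs nonempty: from h(A) = hC gs,
--               attach a leaf at depth c-1 and increment depths 0..c-1;
--          (iii) hC (fs ▸ t) with fs nonempty: glue h(B) = hT t and
--               h(A) = hC fs.

hT : Tree → Tree
hC : Forest → Tree
hT (node c [])       = oneEdge
hT (node c (gs ▸ s)) = graft (c ∸ 1) leaf (hC (gs ▸ s))
hC []                = leaf
hC ([] ▸ t)          = hT t
hC ((fs ▸ s) ▸ t)    = glue (hT t) (hC (fs ▸ s))

h : Tree → Tree
h (node _ fs) = hC fs

buildF1 : Tree → Tree
buildF1 A = fixRoot (addChild A (setRoot 1 (h A)))

-- (F2): A₂' = A₂ with h(A₁) (root label set to 1) attached below the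
-- (b-1)-th rightmost-path node (depth b-2), non-root path nodes at depths
-- 1..b-2 incremented, root label set to b; then attach A₂' as new rightmost
-- child of the root of A₁ and fix the root label.
buildF2' : Tree → ℕ → Tree → Tree
buildF2' A₁ b A₂ = setRoot b (graft (b ∸ 2) (setRoot 1 (h A₁)) A₂)

buildF2 : Tree → ℕ → Tree → Tree
buildF2 A₁ b A₂ = fixRoot (addChild A₁ (buildF2' A₁ b A₂))

module Submission where

-- Write a β-tree with at least two nodes as T = node l (F ▸ t): t is the
-- rightmost child of the root and F the forest of its other children; hT t
-- is h of the tree whose root has t as only child.
--
-- (A) From h(T) = T we extract a subtree w with  rc (hT w) = w  (the rightmost
--     child of hT w is w itself) such that t = glue w (h A), where A is the
--     tree with root children F.  For F nonempty this uses the identity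
--     hT (glue u X) = prepend (h X) (hT u), which keeps the rightmost child.
-- (B) A non-leaf w with rc (hT w) = w is  setRoot (d+2) (graft d leaf A₂)
--     where A₂ satisfies the conditions of (F2) for b = d + 2.  This rests on
--     the rule  hT (graft d leaf t) = node (d+2) [setRoot (d+2) (hT t)]  and
--     on the injectivity of grafting.
-- (C) w a leaf gives (F1); otherwise gluing h(A) into the pattern of (B)
--     gives (F2).

open import Defs
open import Data.Nat using (ℕ; zero; suc; _+_; _∸_; _≤_; _<_; z≤n; s≤s; s≤s⁻¹)
open import Data.Nat.Properties
  using (+-comm; +-suc; ≤-trans; ≤-reflexive; m≤n+m; <⇒≤; suc-injective; module ≤-Reasoning)
open import Data.Product using (Σ; _×_; _,_; proj₁; proj₂)
open import Data.Sum using (_⊎_; inj₁; inj₂)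
open import Data.Empty using (⊥; ⊥-elim)
open import Data.Unit using (⊤; tt)
open import Function using (_∘_)
open import Relation.Binary.PropositionalEquality
  using (_≡_; _≢_; refl; sym; trans; cong; cong₂; subst; module ≡-Reasoning)

rpath : Tree → ℕ
rpath (node _ [])      = 0
rpath (node _ (_ ▸ t)) = suc (rpath t)

children : Tree → Forest
children (node _ fs) = fs

rc : Tree → Tree
rc (node l [])      = node l []
rc (node _ (_ ▸ t)) = t

initF : Forest → Forest
initF []       = []
initF (fs ▸ _) = fs

HasChild : Tree → Set
HasChild (node _ [])      = ⊥
HasChild (node _ (_ ▸ _)) = ⊤

IsBeta⁺ : Tree → Set
IsBeta⁺ (node l [])       = ⊥
IsBeta⁺ (node l (fs ▸ t)) = l ≡ sumF (fs ▸ t) × ForestOK (fs ▸ t)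

β⇒hasChild : ∀ y → IsBeta⁺ y → HasChild y
β⇒hasChild (node l (fs ▸ t)) _ = tt

rc-nonroot : ∀ y → IsBeta⁺ y → NonRootOK (rc y)
rc-nonroot (node l (fs ▸ t)) (_ , _ , nrt) = nrt

deep⇒hasChild : ∀ {d} y → suc d ≤ rpath y → HasChild y
deep⇒hasChild (node l (fs ▸ t)) _ = tt

rpath-rc : ∀ y → HasChild y → rpath y ≡ suc (rpath (rc y))
rpath-rc (node l (fs ▸ t)) _ = refl

leaf≢inner : ∀ {l fs t} → leaf ≢ node l (fs ▸ t)
leaf≢inner ()

rpath-setRoot : ∀ m y → rpath (setRoot m y) ≡ rpath y
rpath-setRoot m (node l [])      = refl
rpath-setRoot m (node l (_ ▸ _)) = refl

graft-hasChild : ∀ d x y → HasChild y → HasChild (graft d x y)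
graft-hasChild zero    x (node l (fs ▸ t)) _ = tt
graft-hasChild (suc d) x (node l (fs ▸ t)) _ = tt

glue-hasChild : ∀ y x → HasChild y → HasChild (glue y x)
glue-hasChild (node l (fs ▸ t)) x _ = tt

hT-hasChild : ∀ t → HasChild (hT t)
hC-hasChild : ∀ fs t → HasChild (hC (fs ▸ t))
hT-hasChild (node c [])       = tt
hT-hasChild (node c (gs ▸ s)) = graft-hasChild (c ∸ 1) leaf (hC (gs ▸ s)) (hC-hasChild gs s)
hC-hasChild [] t        = hT-hasChild t
hC-hasChild (fs ▸ s) t  = glue-hasChild (hT t) (hC (fs ▸ s)) (hT-hasChild t)

rc-graft-zero : ∀ x y → rc (graft 0 x y) ≡ x
rc-graft-zero x (node l fs) = refl

rc-graft-suc : ∀ d x y → HasChild y → rc (graft (suc d) x y) ≡ graft d x (rc y)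
rc-graft-suc d x (node l (fs ▸ t)) _ = refl

rpath-graft : ∀ d y → d ≤ rpath y → rpath (graft d leaf y) ≡ suc d
rpath-graft zero    (node l ys)       _         = refl
rpath-graft (suc d) (node l (fs ▸ u)) (s≤s d≤) = cong suc (rpath-graft d u d≤)

rpath-glue : ∀ y x → rpath (glue y x) ≡ rpath y + rpath x
rpath-glue (node l [])       x = rpath-setRoot 1 x
rpath-glue (node l (fs ▸ u)) x = cong suc (rpath-glue u x)

graft-setRoot : ∀ d x m y → HasChild y → graft d x (setRoot m y) ≡ setRoot (suc m) (graft d x y)
graft-setRoot zero    x m (node l (fs ▸ t)) _ = refl
graft-setRoot (suc d) x m (node l (fs ▸ t)) _ = refl

glue-setRoot : ∀ m y x → HasChild y → glue (setRoot m y) x ≡ setRoot m (glue y x)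
glue-setRoot m (node l (fs ▸ t)) x _ = refl

glue-graft : ∀ d y x → d ≤ rpath y → glue (graft d leaf y) x ≡ graft d (setRoot 1 x) y
glue-graft zero    (node l ys)       x _         = refl
glue-graft (suc d) (node l (fs ▸ u)) x (s≤s d≤) = cong (λ v → node (suc l) (fs ▸ v)) (glue-graft d u x d≤)

-- a β-subtree ends in a leaf of label 1, so gluing the one-node tree changes nothing
glue-leaf : ∀ w → NonRootOK w → glue w leaf ≡ w
glue-leaf (node l [])       refl            = refl
glue-leaf (node l (fs ▸ u)) (_ , _ , _ , nu) = cong (λ v → node l (fs ▸ v)) (glue-leaf u nu)

glue-inversion : ∀ y x l F t → HasChild y → glue y x ≡ node l (F ▸ t) →
  Σ Tree λ w → y ≡ node l (F ▸ w) × glue w x ≡ t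
glue-inversion (node m (G ▸ w)) x l F t _ refl = w , refl , refl

label-positive : ∀ t → NonRootOK t → 1 ≤ label t
label-positive (node l [])      refl      = s≤s z≤n
label-positive (node l (_ ▸ _)) (1≤l , _) = 1≤l

sum-positive : ∀ fs t → ForestOK (fs ▸ t) → 1 ≤ sumF (fs ▸ t)
sum-positive fs t (_ , nt) = ≤-trans (label-positive t nt) (m≤n+m (label t) (sumF fs))

sum-bump : ∀ fs u v → label v ≡ suc (label u) → suc (sumF (fs ▸ u)) ≡ sumF (fs ▸ v)
sum-bump fs u v lab = trans (sym (+-suc (sumF fs) (label u))) (cong (sumF fs +_) (sym lab))

graft-nonroot : ∀ d t → NonRootOK t → suc d ≤ rpath t →
  NonRootOK (graft d leaf t) × label (graft d leaf t) ≡ suc (label t)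
graft-nonroot d (node l []) _ ()
graft-nonroot zero (node l (fs ▸ u)) (_ , l≤ , fok) _ =
  (s≤s z≤n , ≤-trans (s≤s l≤) (≤-reflexive (+-comm 1 (sumF (fs ▸ u)))) , fok , refl) , refl
graft-nonroot (suc d) (node l (fs ▸ u)) (_ , l≤ , fok , nu) (s≤s d<) =
  let (nu' , lab) = graft-nonroot d u nu d<
  in (s≤s z≤n , ≤-trans (s≤s l≤) (≤-reflexive (sum-bump fs u (graft d leaf u) lab)) , fok , nu') , refl

graft-β : ∀ d y → IsBeta⁺ y → suc d ≤ rpath y → IsBeta⁺ (graft d leaf y)
graft-β d (node l []) ()
graft-β zero (node l (fs ▸ u)) (e , fok) _ = trans (cong suc e) (+-comm 1 (sumF (fs ▸ u))) , fok , refl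
graft-β (suc d) (node l (fs ▸ u)) (e , fok , nu) (s≤s d<) =
  let (nu' , lab) = graft-nonroot d u nu d<
  in trans (cong suc e) (sum-bump fs u (graft d leaf u) lab) , fok , nu'

glue-nonroot : ∀ t x → NonRootOK t → IsBeta⁺ x → NonRootOK (glue t x) × label (glue t x) ≡ label t
glue-nonroot (node l []) (node xl []) _ ()
glue-nonroot (node l []) (node xl (xs ▸ xu)) refl (_ , fok) = (s≤s z≤n , sum-positive xs xu fok , fok) , refl
glue-nonroot (node l (fs ▸ u)) x (1≤l , l≤ , fok , nu) βx =
  let (nu' , lab) = glue-nonroot u x nu βx
  in (1≤l , subst (λ m → l ≤ sumF fs + m) (sym lab) l≤ , fok , nu') , refl

glue-β : ∀ y x → IsBeta⁺ y → IsBeta⁺ x → IsBeta⁺ (glue y x)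
glue-β (node l []) x ()
glue-β (node l (fs ▸ u)) x (e , fok , nu) βx =
  let (nu' , lab) = glue-nonroot u x nu βx
  in trans e (cong (sumF fs +_) (sym lab)) , fok , nu'

h-β-single : ∀ t → NonRootOK t → IsBeta⁺ (hT t) × rpath (hT t) ≡ label t
h-β-forest : ∀ fs t → ForestOK (fs ▸ t) → IsBeta⁺ (hC (fs ▸ t)) × rpath (hC (fs ▸ t)) ≡ sumF (fs ▸ t)
h-β-single (node c []) refl = (refl , tt , refl) , refl
h-β-single (node zero (gs ▸ s)) (() , _)
h-β-single (node (suc c) (gs ▸ s)) (_ , c< , fok) =
  let (βH , rpH) = h-β-forest gs s fok
      c<rpath    = subst (suc c ≤_) (sym rpH) c<
  in graft-β c (hC (gs ▸ s)) βH c<rpath , rpath-graft c (hC (gs ▸ s)) (<⇒≤ c<rpath)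
h-β-forest [] t (_ , nt) = h-β-single t nt
h-β-forest (fs ▸ s) t (fok , nt) =
  let (βT , rpT) = h-β-single t nt
      (βC , rpC) = h-β-forest fs s fok
  in glue-β (hT t) (hC (fs ▸ s)) βT βC
   , trans (rpath-glue (hT t) (hC (fs ▸ s)))
           (trans (cong₂ _+_ rpT rpC) (+-comm (label t) (sumF (fs ▸ s))))

_++F_ : Forest → Forest → Forest
xs ++F []       = xs
xs ++F (ys ▸ y) = (xs ++F ys) ▸ y

prepend : Tree → Tree → Tree
prepend (node a xs) (node m ys) = node (a + m) (xs ++F ys)

rc-prepend : ∀ p y → HasChild y → rc (prepend p y) ≡ rc y
rc-prepend (node a xs) (node m (ys ▸ u)) _ = refl

graft-zero-prepend : ∀ p → graft 0 leaf p ≡ prepend p oneEdge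
graft-zero-prepend (node a hs) = cong (λ n → node n (hs ▸ leaf)) (+-comm 1 a)

graft-prepend : ∀ d x p y → HasChild y → graft d x (prepend p y) ≡ prepend p (graft d x y)
graft-prepend zero    x (node a xs) (node m (ys ▸ u)) _ = cong (λ n → node n (((xs ++F ys) ▸ u) ▸ x)) (sym (+-suc a m))
graft-prepend (suc d) x (node a xs) (node m (ys ▸ u)) _ = cong (λ n → node n ((xs ++F ys) ▸ graft d x u)) (sym (+-suc a m))

glue-prepend : ∀ p y x → HasChild y → glue (prepend p y) x ≡ prepend p (glue y x)
glue-prepend (node a xs) (node m (ys ▸ u)) x _ = refl

-- replacing the rightmost leaf of u by X only adds the root children of h(X)
-- to the left of those of hT u (clause (iii) applied to X)
h-glue : ∀ u X → HasChild X → hT (glue u X) ≡ prepend (h X) (hT u)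
h-glue (node c []) (node xl []) ()
h-glue (node c []) (node xl (xs ▸ xu)) _ = graft-zero-prepend (hC (xs ▸ xu))
h-glue (node c ([] ▸ s)) X hasX =
  trans (cong (graft (c ∸ 1) leaf) (h-glue s X hasX))
        (graft-prepend (c ∸ 1) leaf (h X) (hT s) (hT-hasChild s))
h-glue (node c ((fs ▸ r) ▸ s)) X hasX =
  let Z = hC (fs ▸ r) in
  trans (cong (graft (c ∸ 1) leaf)
              (trans (cong (λ y → glue y Z) (h-glue s X hasX))
                     (glue-prepend (h X) (hT s) Z (hT-hasChild s))))
        (graft-prepend (c ∸ 1) leaf (h X) (glue (hT s) Z) (glue-hasChild (hT s) Z (hT-hasChild s)))

hC-replace-last : ∀ ts u g m → hT g ≡ node m ([] ▸ setRoot m (hT u)) →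
  hC (ts ▸ g) ≡ node m ([] ▸ setRoot m (hC (ts ▸ u)))
hC-replace-last [] u g m e = e
hC-replace-last (fs ▸ r) u g m e =
  trans (cong (λ y → glue y (hC (fs ▸ r))) e)
        (cong (λ y → node m ([] ▸ y)) (glue-setRoot m (hT u) (hC (fs ▸ r)) (hT-hasChild u)))

h-graft : ∀ d t → NonRootOK t → d ≤ rpath t →
  hT (graft d leaf t) ≡ node (suc (suc d)) ([] ▸ setRoot (suc (suc d)) (hT t))
h-graft zero (node .1 []) refl _ = refl
h-graft zero (node zero (ts ▸ u)) (() , _) _
h-graft zero (node (suc k) (ts ▸ u)) _ _ =
  cong (λ y → node 2 ([] ▸ y)) (graft-setRoot k leaf 1 (hC (ts ▸ u)) (hC-hasChild ts u))
h-graft (suc d) (node k []) _ ()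
h-graft (suc d) (node zero (ts ▸ u)) (() , _) _
h-graft (suc d) (node (suc k) (ts ▸ u)) (_ , _ , _ , nu) (s≤s d≤) = begin
    graft (suc k) leaf (hC (ts ▸ graft d leaf u))
  ≡⟨ cong (graft (suc k) leaf) (hC-replace-last ts u (graft d leaf u) b (h-graft d u nu d≤)) ⟩
    node (suc b) ([] ▸ graft k leaf (setRoot b (hC (ts ▸ u))))
  ≡⟨ cong (λ y → node (suc b) ([] ▸ y)) (graft-setRoot k leaf b (hC (ts ▸ u)) (hC-hasChild ts u)) ⟩
    node (suc b) ([] ▸ setRoot (suc b) (graft k leaf (hC (ts ▸ u))))
  ∎
  where
  open ≡-Reasoning
  b = suc (suc d)

nodeEq : ∀ {a b fs fs' u u'} → a ≡ b → fs ≡ fs' → u ≡ u' → node a (fs ▸ u) ≡ node b (fs' ▸ u')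
nodeEq refl refl refl = refl

graft-injective : ∀ d x t t' → graft d x t ≡ graft d x t' → t ≡ t'
graft-injective zero    x (node a ys) (node b ys') refl = refl
graft-injective (suc d) x (node a []) (node b []) refl = refl
graft-injective (suc d) x (node a []) (node b (_ ▸ _)) ()
graft-injective (suc d) x (node a (_ ▸ _)) (node b []) ()
graft-injective (suc d) x (node a (fs ▸ u)) (node b (fs' ▸ u')) eq =
  nodeEq (suc-injective (cong label eq)) (cong (initF ∘ children) eq) (graft-injective d x u u' (cong rc eq))

graft-cancel : ∀ d x y y' e → graft d x y ≡ setRoot e (graft d x y') → children y ≡ children y'
graft-cancel zero    x (node a ys) (node b ys') e refl = refl
graft-cancel (suc d) x (node a []) (node b []) e refl = refl
graft-cancel (suc d) x (node a []) (node b (_ ▸ _)) e ()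
graft-cancel (suc d) x (node a (_ ▸ _)) (node b []) e ()
graft-cancel (suc d) x (node a (fs ▸ t)) (node b (fs' ▸ t')) e eq =
  cong₂ _▸_ (cong (initF ∘ children) eq) (graft-injective d x t t' (cong rc eq))

β-by-children : ∀ H F → IsBeta⁺ H → children H ≡ F → H ≡ node (sumF F) F
β-by-children (node l (fs ▸ t)) .(fs ▸ t) (e , _) refl = cong (λ n → node n (fs ▸ t)) e

-- the conditions (F2) imposes on A₂ for b = d + 2
F2Conditions : ℕ → Tree → Set
F2Conditions d A = IsBeta A × 2 ≤ size A × h A ≡ A × suc d ≤ root A

size-inner : ∀ a fs t → 2 ≤ size (node a (fs ▸ t))
size-inner a fs (node b us) = s≤s (≤-trans (s≤s z≤n) (m≤n+m (size (node b us)) (sizeF fs)))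

-- for an h-fixed tree, rpath(A) = rpath(h A) = root(A) ≥ d + 1; needed to
-- glue below the graft point of A₂
F2-rpath : ∀ d A → F2Conditions d A → suc d ≤ rpath A
F2-rpath d (node a []) (_ , s≤s () , _)
F2-rpath d (node a (fs ▸ t)) ((e , fok) , _ , fixed , d<a) = begin
    suc d                ≤⟨ d<a ⟩
    a                    ≡⟨ e ⟩
    sumF (fs ▸ t)        ≡⟨ sym (proj₂ (h-β-forest fs t fok)) ⟩
    rpath (hC (fs ▸ t))  ≡⟨ cong rpath fixed ⟩
    rpath (node a (fs ▸ t)) ∎
  where open ≤-Reasoning

-- If grafting a leaf into zt reproduces h(zt) up to the root label, then
-- comparing rightmost paths gives label zt = d + 1 ...
fixed-label : ∀ d m zt → NonRootOK zt → d ≤ rpath zt → graft d leaf zt ≡ setRoot m (hT zt) →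
  label zt ≡ suc d
fixed-label d m zt nr d≤ eq = begin
    label zt                   ≡⟨ sym (proj₂ (h-β-single zt nr)) ⟩
    rpath (hT zt)              ≡⟨ sym (rpath-setRoot m (hT zt)) ⟩
    rpath (setRoot m (hT zt))  ≡⟨ cong rpath (sym eq) ⟩
    rpath (graft d leaf zt)    ≡⟨ rpath-graft d zt d≤ ⟩
    suc d                      ∎
  where open ≡-Reasoning

-- ... and then injectivity of grafting shows that fixRoot zt is a fixed
-- point of h satisfying (F2).
fixed-rightChild : ∀ d zt → NonRootOK zt → suc d ≤ rpath zt →
  graft d leaf zt ≡ setRoot (suc (suc d)) (hT zt) →
  hT zt ≡ graft d leaf (fixRoot zt) × F2Conditions d (fixRoot zt)
fixed-rightChild d (node zl []) _ () _
fixed-rightChild d (node zl (fs ▸ u)) nr d< eq with fixed-label d (suc (suc d)) (node zl (fs ▸ u)) nr (<⇒≤ d<) eq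
... | refl = cong (graft d leaf) hFixed , (refl , fok) , size-inner (sumF (fs ▸ u)) fs u , hFixed , zl≤
  where
  zl≤ = proj₁ (proj₂ nr)
  fok = proj₂ (proj₂ nr)
  hFixed : hC (fs ▸ u) ≡ node (sumF (fs ▸ u)) (fs ▸ u)
  hFixed = β-by-children (hC (fs ▸ u)) (fs ▸ u) (proj₁ (h-β-forest fs u fok))
             (sym (graft-cancel d leaf (node (suc d) (fs ▸ u)) (hC (fs ▸ u)) (suc (suc d)) eq))

self-similar : ∀ w → NonRootOK w → rc (hT w) ≡ w →
  (w ≡ leaf) ⊎ (Σ ℕ λ d → Σ Tree λ A₂ → w ≡ setRoot (suc (suc d)) (graft d leaf A₂) × F2Conditions d A₂)
self-similar (node l []) refl _ = inj₁ refl
self-similar (node zero (ws ▸ wt)) (() , _) _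
self-similar (node 1 (ws ▸ wt)) _ self =
  ⊥-elim (leaf≢inner (trans (sym (rc-graft-zero leaf (hC (ws ▸ wt)))) self))
self-similar w@(node (suc (suc d)) (ws ▸ wt)) (_ , b≤ , fok) self =
  inj₂ (d , fixRoot zt , w≡ , proj₂ fixedZt)
  where
  b  = suc (suc d)
  H  = hC (ws ▸ wt)
  βH = h-β-forest ws wt fok
  zt = rc H
  nrZt = rc-nonroot H (proj₁ βH)
  w≡graft : w ≡ graft d leaf zt
  w≡graft = trans (sym self) (rc-graft-suc d leaf H (β⇒hasChild H (proj₁ βH)))
  d<rpath : suc d ≤ rpath zt
  d<rpath = s≤s⁻¹ (begin
      b                  ≤⟨ b≤ ⟩
      sumF (ws ▸ wt)     ≡⟨ sym (proj₂ βH) ⟩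
      rpath H            ≡⟨ rpath-rc H (β⇒hasChild H (proj₁ βH)) ⟩
      suc (rpath zt)     ∎)
    where open ≤-Reasoning
  graft≡h : graft d leaf zt ≡ setRoot b (hT zt)
  graft≡h = begin
      graft d leaf zt               ≡⟨ sym w≡graft ⟩
      w                             ≡⟨ sym self ⟩
      rc (hT w)                     ≡⟨ cong (rc ∘ hT) w≡graft ⟩
      rc (hT (graft d leaf zt))     ≡⟨ cong rc (h-graft d zt nrZt (<⇒≤ d<rpath)) ⟩
      setRoot b (hT zt)             ∎
    where open ≡-Reasoning
  fixedZt = fixed-rightChild d zt nrZt d<rpath graft≡h
  w≡ : w ≡ setRoot b (graft d leaf (fixRoot zt))
  w≡ = trans w≡graft (trans graft≡h (cong (setRoot b) (proj₁ fixedZt)))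

rightmost-child : ∀ l F t → IsBeta (node l (F ▸ t)) → h (node l (F ▸ t)) ≡ node l (F ▸ t) →
  Σ Tree λ w → NonRootOK w × rc (hT w) ≡ w × t ≡ glue w (hC F)
rightmost-child l [] t (_ , _ , nrt) fixed = t , nrt , cong rc fixed , sym (glue-leaf t nrt)
rightmost-child l (fs ▸ s) t (_ , _ , nrt) fixed =
  w , nrW , selfW , sym glued
  where
  X = hC (fs ▸ s)
  split = glue-inversion (hT t) X l (fs ▸ s) t (hT-hasChild t) fixed
  w = proj₁ split
  hT≡ = proj₁ (proj₂ split)
  glued = proj₂ (proj₂ split)
  nrW : NonRootOK w
  nrW = proj₂ (proj₂ (subst IsBeta⁺ hT≡ (proj₁ (h-β-single t nrt))))
  selfW : rc (hT w) ≡ w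
  selfW = begin
      rc (hT w)                 ≡⟨ sym (rc-prepend (h X) (hT w) (hT-hasChild w)) ⟩
      rc (prepend (h X) (hT w)) ≡⟨ cong rc (sym (h-glue w X (hC-hasChild fs s))) ⟩
      rc (hT (glue w X))        ≡⟨ cong (rc ∘ hT) glued ⟩
      rc (hT t)                 ≡⟨ cong rc hT≡ ⟩
      w                         ∎
    where open ≡-Reasoning

rootLabel : Forest → ℕ
rootLabel []       = 1
rootLabel (fs ▸ t) = sumF (fs ▸ t)

rootOf : Forest → Tree
rootOf F = node (rootLabel F) F

rootOf-β : ∀ F → ForestOK F → IsBeta (rootOf F)
rootOf-β []       _   = refl
rootOf-β (fs ▸ t) fok = refl , fok

attached : ∀ {l F t} → IsBeta (node l (F ▸ t)) → node l (F ▸ t) ≡ fixRoot (addChild (rootOf F) t)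
attached (e , _) = cong (λ n → node n (_ ▸ _)) e

lemma3 : (T : Tree) → IsBeta T → h T ≡ T →
    (T ≡ leaf)
    ⊎ (Σ Tree λ A → IsBeta A × T ≡ buildF1 A)
    ⊎ (Σ Tree λ A₁ → Σ ℕ λ b → Σ Tree λ A₂ →
    IsBeta A₁ × 1 < b × IsBeta A₂ × 2 ≤ size A₂ × h A₂ ≡ A₂ × b ∸ 1 ≤ root A₂
    × T ≡ buildF2 A₁ b A₂)
lemma3 (node l []) β _ = inj₁ (cong (λ n → node n []) β)
lemma3 (node l (F ▸ t)) β fixed with rightmost-child l F t β fixed
... | w , nrW , self , t≡ with self-similar w nrW self
... | inj₁ refl = inj₂ (inj₁ (rootOf F , rootOf-β F (proj₁ (proj₂ β)) , T≡))
  where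
  T≡ : node l (F ▸ t) ≡ buildF1 (rootOf F)
  T≡ = trans (attached β) (cong (fixRoot ∘ addChild (rootOf F)) t≡)
... | inj₂ (d , A₂ , refl , conds@(βA₂ , size≥ , fixedA₂ , d<root)) =
  inj₂ (inj₂ (rootOf F , suc (suc d) , A₂ , rootOf-β F (proj₁ (proj₂ β)) , s≤s (s≤s z≤n)
             , βA₂ , size≥ , fixedA₂ , d<root , T≡))
  where
  X = hC F
  deep = F2-rpath d A₂ conds
  hasGraft = graft-hasChild d leaf A₂ (deep⇒hasChild A₂ deep)
  t≡' : t ≡ buildF2' (rootOf F) (suc (suc d)) A₂
  t≡' = trans t≡ (trans (glue-setRoot (suc (suc d)) (graft d leaf A₂) X hasGraft)
                        (cong (setRoot (suc (suc d))) (glue-graft d A₂ X (<⇒≤ deep))))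
  T≡ : node l (F ▸ t) ≡ buildF2 (rootOf F) (suc (suc d)) A₂
  T≡ = trans (attached β) (cong (fixRoot ∘ addChild (rootOf F)) t≡')
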